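{- Let $G=(V,E)$ be a directed unweighted graph and let $H_d$ be a $d$-hub set of $G$. Suppose we are given two collections $\mathcal{T}^{\mathrm{from}}=\{T^{\mathrm{from}}_v:v\in H_d\}$ and $\mathcal{T}^{\mathrm{to}}=\{T^{\mathrm{to}}_v:v\in H_d\}$ of shortest path trees up to depth $d$ from all vertices of $H_d$ in $G$ and in the reverse graph $\overleftarrow{G}$, respectively. Let $B$ be a $(\mathcal{T}^{\mathrm{from}}\cup \mathcal{T}^{\mathrm{to}},d)$-blocker set. Then $B$ is a $6d$-hub set of $G$.
   Context: $\overleftarrow{G}$ is $G$ with all edges reversed. Distances count edges. A shortest path tree from $s$ up to depth $d$ is an out-tree $T\subseteq G$ rooted at $s$ with $v\in V(T)$ iff $\delta_G(s,v)\le d$, and $\delta_T(s,v)=\delta_G(s,v)$ for $v\in V(T)$. For a rooted tree $T$ of depth at most $d$, $B$ is a $(T,d)$-blocker set if every vertex at depth exactly $d$ in $T$ or one of its ancestors is in $B$; for a collection, this must hold for every tree. A path is $(H,k)$-covered if it equals $P_1\cdots P_r$ with $P_i$ a $u_i\to v_i$ path with at most $k$ edges and $u_i\in H$ for $i\ge2$. $H$ is a $k$-hub set of $G$ if for all $u,v$ with $\delta_G(u,v)<\infty$ some shortest $u\to v$ path is $(H,k)$-covered. -}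

module Defs where

open import Data.Nat using (ℕ; zero; suc; _≤_; _*_)
open import Data.Fin using (Fin)
open import Data.Fin.Subset using (Subset; _∈_; _∉_)
open import Data.Bool using (Bool; true)
open import Data.Product using (Σ; _×_; ∃; ∃-syntax)
open import Data.Sum using (_⊎_)
open import Function using (_⇔_)
open import Relation.Binary.PropositionalEquality using (_≡_; _≢_)

Graph : ℕ → Set
Graph n = Fin n → Fin n → Bool

rev : ∀ {n} → Graph n → Graph n
rev E u v = E v u

data Walk {n} (E : Graph n) : Fin n → Fin n → Set where
  []  : (u : Fin n) → Walk E u u
  _∷_ : ∀ {u w v} → E u w ≡ true → Walk E w v → Walk E u v

length : ∀ {n} {E : Graph n} {u v} → Walk E u v → ℕ
length ([] _)  = zero
length (_ ∷ p) = suc (length p)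

_++_ : ∀ {n} {E : Graph n} {u w v} → Walk E u w → Walk E w v → Walk E u v
[] _    ++ q = q
(e ∷ p) ++ q = e ∷ (p ++ q)

Reachable : ∀ {n} → Graph n → Fin n → Fin n → Set
Reachable E u v = Walk E u v

DistLe : ∀ {n} → Graph n → Fin n → Fin n → ℕ → Set
DistLe E u v k = Σ (Walk E u v) λ p → length p ≤ k

DistEq : ∀ {n} → Graph n → Fin n → Fin n → ℕ → Set
DistEq E u v k = (Σ (Walk E u v) λ p → length p ≡ k)
               × ((q : Walk E u v) → k ≤ length q)

Shortest : ∀ {n} {E : Graph n} {u v} → Walk E u v → Set
Shortest {E = E} {u} {v} p = (q : Walk E u v) → length p ≤ length q

-- p = P_2 ⋯ P_r  (r ≥ 2), each P_i with ≤ k edges and starting in H.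
data Chain {n} {E : Graph n} (H : Subset n) (k : ℕ) : ∀ {u v} → Walk E u v → Set where
  one  : ∀ {u v} (p : Walk E u v) → u ∈ H → length p ≤ k → Chain H k p
  more : ∀ {u w v} (p : Walk E u w) (q : Walk E w v) (r : Walk E u v) →
         r ≡ p ++ q → u ∈ H → length p ≤ k → Chain H k q → Chain H k r

Covered : ∀ {n} {E : Graph n} → Subset n → ℕ → ∀ {u v} → Walk E u v → Set
Covered {E = E} H k {u} {v} p =
  (length p ≤ k) ⊎
  (∃[ w ] Σ (Walk E u w) λ p₁ → Σ (Walk E w v) λ q →
     (p ≡ p₁ ++ q) × (length p₁ ≤ k) × Chain H k q)

IsHubSet : ∀ {n} → Graph n → Subset n → ℕ → Set
IsHubSet {n} E H k = (u v : Fin n) → Reachable E u v →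
  Σ (Walk E u v) λ p → Shortest p × Covered H k p

iter : ∀ {n} → (Fin n → Fin n) → ℕ → Fin n → Fin n
iter f zero    x = x
iter f (suc i) x = f (iter f i x)

-- The out-tree is given
-- by its vertex set, a parent map (parent of each non-root tree vertex,
-- with the tree edge (parent v , v) an edge of G) and the depth function
-- depth v = delta_T(s,v) (number of parent steps back to s).
record SPTree {n} (E : Graph n) (s : Fin n) (d : ℕ) : Set where
  field
    verts      : Subset n
    parent     : Fin n → Fin n
    depth      : Fin n → ℕ
    root∈      : s ∈ verts
    root-depth : depth s ≡ 0
    parent∈    : ∀ v → v ∈ verts → v ≢ s → parent v ∈ verts
    parent-edge : ∀ v → v ∈ verts → v ≢ s → E (parent v) v ≡ true
    parent-depth : ∀ v → v ∈ verts → v ≢ s → depth v ≡ suc (depth (parent v))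
    verts-spec : ∀ v → (v ∈ verts ⇔ DistLe E s v d)
    depth-spec : ∀ v → v ∈ verts → DistEq E s v (depth v)

-- B is a (T,d)-blocker set: each tree vertex at depth exactly d, or one of
-- its ancestors (iter parent i v, 1 ≤ i ≤ depth v; i = 0 is v itself), is in B.
Blocks : ∀ {n} {E : Graph n} {s d} → SPTree E s d → Subset n → Set
Blocks {n} {d = d} T B = ∀ v → v ∈ verts → depth v ≡ d →
  ∃[ i ] (i ≤ depth v) × (iter parent i v ∈ B)
  where open SPTree T

module Submission where

-- Drop the first edge of a shortest path longer than 2d + 1. By the hub property the rest
-- is a shortest path that reaches some h ∈ H within d edges; the vertex x at distance d from
-- h along it has depth exactly d in the forward tree of h, so some ancestor b of x lies in B.
-- Rerouting along the tree through b keeps the path shortest and puts b at most 2d + 1 edges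
-- after the start, so iterating cuts the path into pieces of at most 2d + 1 ≤ 6d edges, all
-- but the first starting in B (for d = 0 all shortest paths are empty).

open import Defs
open import Data.Nat using (ℕ; zero; suc; _+_; _*_; _≤_; _<_; z≤n; s≤s; _≤?_)
open import Data.Nat.Properties
open import Data.Fin using (Fin)
open import Data.Fin.Subset using (Subset; _∈_)
open import Data.Product using (_×_; Σ; _,_; proj₁; proj₂; ∃-syntax)
open import Data.Sum using (inj₁; inj₂)
open import Data.Empty using (⊥-elim)
open import Relation.Nullary using (yes; no)
open import Relation.Binary.PropositionalEquality
open import Function using (Equivalence)

private variable
  n d k m ℓ : ℕ
  E : Graph n
  H B : Subset n
  s u v w : Fin n

length-++ : (p : Walk E u w) (q : Walk E w v) → length (p ++ q) ≡ length p + length q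
length-++ ([] _) q = refl
length-++ (e ∷ p) q = cong suc (length-++ p q)

splitAt : (k : ℕ) (p : Walk E u v) → k ≤ length p →
  ∃[ x ] Σ (Walk E u x) λ a → Σ (Walk E x v) λ b →
    length a ≡ k × length a + length b ≡ length p
splitAt zero p _ = _ , [] _ , p , refl , refl
splitAt (suc k) (e ∷ p) (s≤s k≤p) with splitAt k p k≤p
... | x , a , b , |a| , |a|+|b| = x , e ∷ a , b , cong suc |a| , cong suc |a|+|b|

shortest-resp-length : {p q : Walk E u v} → Shortest p → length q ≡ length p → Shortest q
shortest-resp-length sh q≡p z = subst (_≤ length z) (sym q≡p) (sh z)

shortest-prefix : {p : Walk E u v} → Shortest p → (a : Walk E u w) (b : Walk E w v) →
  length a + length b ≡ length p → Shortest a
shortest-prefix sh a b a+b z = +-cancelʳ-≤ (length b) (length a) (length z)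
  (subst₂ _≤_ (sym a+b) (length-++ z b) (sh (z ++ b)))

shortest-suffix : {p : Walk E u v} → Shortest p → (a : Walk E u w) (b : Walk E w v) →
  length a + length b ≡ length p → Shortest b
shortest-suffix sh a b a+b z = +-cancelˡ-≤ (length a) (length b) (length z)
  (subst₂ _≤_ (sym a+b) (length-++ a z) (sh (a ++ z)))

chain-head : {q : Walk E u v} → Chain H k q → u ∈ H
chain-head (one _ u∈ _) = u∈
chain-head (more _ _ _ _ u∈ _ _) = u∈

Chain-mono : k ≤ m → {q : Walk E u v} → Chain H k q → Chain H m q
Chain-mono k≤m (one p u∈ p≤k) = one p u∈ (≤-trans p≤k k≤m)
Chain-mono k≤m (more p q r r≡ u∈ p≤k c) = more p q r r≡ u∈ (≤-trans p≤k k≤m) (Chain-mono k≤m c)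

Covered-mono : k ≤ m → {p : Walk E u v} → Covered H k p → Covered H m p
Covered-mono k≤m (inj₁ p≤k) = inj₁ (≤-trans p≤k k≤m)
Covered-mono k≤m (inj₂ (w , p₁ , q , p≡ , p₁≤k , c)) =
  inj₂ (w , p₁ , q , p≡ , ≤-trans p₁≤k k≤m , Chain-mono k≤m c)

IsHubSet-mono : k ≤ m → IsHubSet E H k → IsHubSet E H m
IsHubSet-mono k≤m hub u v r with hub u v r
... | p , sh , cov = p , sh , Covered-mono k≤m cov

Chain-length-zero : {q : Walk E u v} → Chain H 0 q → length q ≡ 0
Chain-length-zero (one _ _ q≤0) = n≤0⇒n≡0 q≤0
Chain-length-zero (more p q r r≡ _ p≤0 c) = begin
  length r            ≡⟨ cong length r≡ ⟩
  length (p ++ q)     ≡⟨ length-++ p q ⟩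
  length p + length q ≡⟨ cong₂ _+_ (n≤0⇒n≡0 p≤0) (Chain-length-zero c) ⟩
  0                   ∎
  where open ≡-Reasoning

Covered-length-zero : {p : Walk E u v} → Covered H 0 p → length p ≡ 0
Covered-length-zero (inj₁ p≤0) = n≤0⇒n≡0 p≤0
Covered-length-zero (inj₂ (_ , p₁ , q , p≡ , p₁≤0 , c)) =
  trans (cong length p≡) (trans (length-++ p₁ q) (cong₂ _+_ (n≤0⇒n≡0 p₁≤0) (Chain-length-zero c)))

IsHubSet-zero : IsHubSet E H 0 → IsHubSet E B 0
IsHubSet-zero hub u v r with hub u v r
... | p , sh , cov = p , sh , inj₁ (≤-reflexive (Covered-length-zero cov))

hubSet-shortest : IsHubSet E H k → Reachable E u v → Σ (Walk E u v) Shortest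
hubSet-shortest hub r with hub _ _ r
... | p , sh , _ = p , sh

record HubSplit (E : Graph n) (H : Subset n) (k : ℕ) (u v : Fin n) (ℓ : ℕ) : Set where
  constructor detour
  field
    via     : Fin n
    via∈    : via ∈ H
    head    : Walk E u via
    tail    : Walk E via v
    head≤   : length head ≤ k
    lengths : length head + length tail ≡ ℓ

prepend : (r : Walk E u w) → length r ≤ m → HubSplit E B k w v ℓ →
  HubSplit E B (m + k) u v (length r + ℓ)
prepend {ℓ = ℓ} r r≤m (detour b b∈ a c a≤k a+c) =
  detour b b∈ (r ++ a) c (≤-trans (≤-reflexive (length-++ r a)) (+-mono-≤ r≤m a≤k)) lengths
  where
  open ≡-Reasoning
  lengths : length (r ++ a) + length c ≡ length r + ℓ
  lengths = begin
    length (r ++ a) + length c       ≡⟨ cong (_+ length c) (length-++ r a) ⟩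
    length r + length a + length c   ≡⟨ +-assoc (length r) (length a) (length c) ⟩
    length r + (length a + length c) ≡⟨ cong (length r +_) a+c ⟩
    length r + ℓ                     ∎

hub-split : IsHubSet E H d → (t : Walk E u v) → Shortest t → d < length t →
  HubSplit E H d u v (length t)
hub-split hub t sh d<t with hub _ _ t
... | r , shr , inj₁ r≤d =
  ⊥-elim (<⇒≱ d<t (subst (_≤ _) (≤-antisym (shr t) (sh r)) r≤d))
... | r , shr , inj₂ (h , r₁ , q , r≡ , r₁≤d , c) =
  detour h (chain-head c) r₁ q r₁≤d
    (trans (sym (length-++ r₁ q)) (trans (cong length (sym r≡)) (≤-antisym (shr t) (sh r))))

module _ {d} (T : SPTree E s d) where
  open SPTree T

  ancestor : ∀ {x} → x ∈ verts → (i : ℕ) → i ≤ depth x →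
    iter parent i x ∈ verts × depth (iter parent i x) + i ≡ depth x ×
    Σ (Walk E (iter parent i x) x) λ a → length a ≡ i
  ancestor x∈ zero _ = x∈ , +-identityʳ _ , [] _ , refl
  ancestor {x} x∈ (suc i) 1+i≤x with ancestor x∈ i (<⇒≤ 1+i≤x)
  ... | y∈ , y+i , a , |a| =
    parent∈ y y∈ y≢s , parent-y+1+i , parent-edge y y∈ y≢s ∷ a , cong suc |a|
    where
    open ≡-Reasoning
    y : Fin _
    y = iter parent i x
    y≢s : y ≢ s
    y≢s y≡s = 1+n≰n (subst (suc i ≤_) x≡i 1+i≤x)
      where
      x≡i : depth x ≡ i
      x≡i = begin
        depth x     ≡⟨ sym y+i ⟩
        depth y + i ≡⟨ cong (λ z → depth z + i) y≡s ⟩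
        depth s + i ≡⟨ cong (_+ i) root-depth ⟩
        i           ∎
    parent-y+1+i : depth (parent y) + suc i ≡ depth x
    parent-y+1+i = begin
      depth (parent y) + suc i   ≡⟨ +-suc _ i ⟩
      suc (depth (parent y) + i) ≡⟨ cong (_+ i) (sym (parent-depth y y∈ y≢s)) ⟩
      depth y + i                ≡⟨ y+i ⟩
      depth x                    ∎

  shortest-depth : ∀ {x} (q : Walk E s x) → Shortest q → length q ≤ d →
    x ∈ verts × depth x ≡ length q
  shortest-depth {x} q sh q≤d with Equivalence.from (verts-spec x) (q , q≤d)
  ... | x∈ with depth-spec x x∈
  ... | (z , |z|) , minimal = x∈ , ≤-antisym (minimal q) (subst (length q ≤_) |z| (sh z))

  reroute : Blocks T B → (q : Walk E s v) → Shortest q → d ≤ length q →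
    HubSplit E B d s v (length q)
  reroute blocks q sh d≤q with splitAt d q d≤q
  ... | x , q₁ , q₂ , |q₁| , q₁+q₂
    with shortest-depth q₁ (shortest-prefix sh q₁ q₂ q₁+q₂) (≤-reflexive |q₁|)
  ... | x∈ , x≡q₁ with blocks x x∈ (trans x≡q₁ |q₁|)
  ... | i , i≤x , b∈ with ancestor x∈ i i≤x
  ... | b∈ᵥ , b+i , c , |c| with depth-spec (iter parent i x) b∈ᵥ
  ... | (a , |a|) , _ = detour _ b∈ a (c ++ q₂) a≤d lengths
    where
    open ≡-Reasoning
    b : Fin _
    b = iter parent i x
    b+i≡q₁ : depth b + i ≡ length q₁
    b+i≡q₁ = trans b+i x≡q₁
    a≤d : length a ≤ d
    a≤d = ≤-trans (≤-reflexive |a|) (subst (depth b ≤_) (trans b+i≡q₁ |q₁|) (m≤m+n _ i))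
    lengths : length a + length (c ++ q₂) ≡ length q
    lengths = begin
      length a + length (c ++ q₂) ≡⟨ cong₂ _+_ |a| (trans (length-++ c q₂) (cong (_+ length q₂) |c|)) ⟩
      depth b + (i + length q₂)   ≡⟨ sym (+-assoc (depth b) i (length q₂)) ⟩
      depth b + i + length q₂     ≡⟨ cong (_+ length q₂) b+i≡q₁ ⟩
      length q₁ + length q₂       ≡⟨ q₁+q₂ ⟩
      length q                    ∎

module _ {k} {B : Subset n}
  (shortest-walk : ∀ {u v} → Reachable E u v → Σ (Walk E u v) Shortest)
  (split : ∀ {u v} (p : Walk E u v) → Shortest p → k < length p →
     Σ (HubSplit E B k u v (length p)) λ σ → 1 ≤ length (HubSplit.head σ)) where

  chain-from : ∀ N → u ∈ B → (p : Walk E u v) → Shortest p → length p ≤ N →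
    Σ (Walk E u v) λ c → length c ≡ length p × Chain B k c
  chain-from zero u∈ p _ p≤0 = p , refl , one p u∈ (≤-trans p≤0 z≤n)
  chain-from (suc N) u∈ p sh p≤N with length p ≤? k
  ... | yes p≤k = p , refl , one p u∈ p≤k
  ... | no p≰k with split p sh (≰⇒> p≰k)
  ... | detour b b∈ a q a≤k a+q , a≥1 with chain-from N b∈ q (shortest-suffix sh a q a+q) q≤N
    where
    q≤N : length q ≤ N
    q≤N = ≤-pred (≤-trans (+-monoˡ-≤ (length q) a≥1) (subst (_≤ suc N) (sym a+q) p≤N))
  ... | c , c≡q , chain =
    a ++ c , trans (length-++ a c) (trans (cong (length a +_) c≡q) a+q) ,
    more a c (a ++ c) refl u∈ a≤k chain

  covering : (p : Walk E u v) → Shortest p →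
    Σ (Walk E u v) λ c → length c ≡ length p × Covered B k c
  covering p sh with length p ≤? k
  ... | yes p≤k = p , refl , inj₁ p≤k
  ... | no p≰k with split p sh (≰⇒> p≰k)
  ... | detour b b∈ a q a≤k a+q , _ with chain-from (length q) b∈ q (shortest-suffix sh a q a+q) ≤-refl
  ... | c , c≡q , chain =
    a ++ c , trans (length-++ a c) (trans (cong (length a +_) c≡q) a+q) ,
    inj₂ (b , a , c , refl , a≤k , chain)

  hubSet-by-splitting : IsHubSet E B k
  hubSet-by-splitting u v r with shortest-walk r
  ... | p , sh with covering p sh
  ... | c , c≡p , cov = c , shortest-resp-length sh c≡p , cov

module _ {H B : Subset n} (hub : IsHubSet E H d)
  (Tfrom : ∀ v → v ∈ H → SPTree E v d) (blocks : ∀ v h → Blocks (Tfrom v h) B) where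

  reroute-long : (t : Walk E u v) → Shortest t → d + d < length t →
    HubSplit E B (d + d) u v (length t)
  reroute-long {u = u} {v = v} t sh 2d<t =
    through-tree (hub-split hub t sh (<-≤-trans (m≤m+n (suc d) d) 2d<t))
    where
    through-tree : HubSplit E H d u v (length t) → HubSplit E B (d + d) u v (length t)
    through-tree (detour h h∈ r q r≤d r+q) =
      subst (HubSplit E B (d + d) u v) r+q
        (prepend r r≤d (reroute (Tfrom h h∈) (blocks h h∈) q (shortest-suffix sh r q r+q) d≤q))
      where
      d≤q : d ≤ length q
      d≤q = <⇒≤ (+-cancelˡ-< d d (length q)
              (<-≤-trans 2d<t (subst (_≤ d + length q) r+q (+-monoˡ-≤ (length q) r≤d))))

  -- The extra first edge makes the split-off prefix nonempty, so splitting always progresses.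
  split-off-blocker : (p : Walk E u v) → Shortest p → suc (d + d) < length p →
    Σ (HubSplit E B (suc (d + d)) u v (length p)) λ σ → 1 ≤ length (HubSplit.head σ)
  split-off-blocker {u = u} (_∷_ {w = y} e t) sh 2d+1<p =
    prepend {m = 1} edge ≤-refl (reroute-long t t-shortest (≤-pred 2d+1<p)) , s≤s z≤n
    where
    edge : Walk E u y
    edge = e ∷ [] y
    t-shortest : Shortest t
    t-shortest = shortest-suffix {p = e ∷ t} sh edge t refl

  blocker-hubSet : IsHubSet E B (suc (d + d))
  blocker-hubSet = hubSet-by-splitting (hubSet-shortest hub) split-off-blocker

1+2m≤6m : 1 ≤ m → suc (m + m) ≤ 6 * m
1+2m≤6m {m} 1≤m = ≤-trans (+-monoˡ-≤ (m + m) 1≤m) (+-monoʳ-≤ m (+-monoʳ-≤ m (m≤m+n m (3 * m))))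

mainTheorem15 : (n : ℕ) (E : Graph n) (d : ℕ) (H : Subset n) →
    IsHubSet E H d →
    (Tfrom : (v : Fin n) → v ∈ H → SPTree E v d) →
    (Tto : (v : Fin n) → v ∈ H → SPTree (rev E) v d) →
    (B : Subset n) →
    ((v : Fin n) (h : v ∈ H) → Blocks (Tfrom v h) B × Blocks (Tto v h) B) →
    IsHubSet E B (6 * d)
mainTheorem15 n E zero H hub Tfrom Tto B blocks = IsHubSet-zero hub
mainTheorem15 n E (suc d) H hub Tfrom Tto B blocks =
  IsHubSet-mono (1+2m≤6m (s≤s z≤n)) (blocker-hubSet hub Tfrom (λ v h → proj₁ (blocks v h)))
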